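{- For every $n\ge 0$, the number of subdiagonal Kimberling paths from $(0,0)$ to $(n+1,n)$ equals the $n$-th large Schröder number, i.e., the number of lattice paths from $(0,0)$ to $(n,n)$ with steps $(1,0)$, $(0,1)$, $(1,1)$ that never go strictly above the line $y=x$.
   Context: A Kimberling path ending at $(n+1,n)$ is a lattice path from $(0,0)$ to $(n+1,n)$ each of whose steps joins two lattice points and has finite nonnegative slope (positive $x$-increment, nonnegative $y$-increment, arbitrary length); equivalently it is a sequence of lattice points from $(0,0)$ to $(n+1,n)$ with strictly increasing $x$-coordinates and weakly increasing $y$-coordinates. It is subdiagonal if it lies weakly below the line joining $(0,0)$ and $(n+1,n)$, i.e., every point satisfies $y\le\frac{n}{n+1}x$. The large Schröder numbers are $1,2,6,22,90,\dots$ for $n=0,1,2,3,4,\dots$. -}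

module Defs where

open import Data.Nat using (ℕ; suc; _*_; _≤_; _<_)

-- Kimberling path for parameter n, as a sequence of lattice points,
-- from the current point (x , y) to the endpoint (n+1 , n).
-- Each step goes to a lattice point (x' , y') with x < x' (positive
-- x-increment) and y ≤ y' (nonnegative y-increment); every visited point
-- is required to be weakly below the line through (0,0) and (n+1,n),
-- i.e. y' ≤ (n/(n+1)) x', written without division as y' * (n+1) ≤ n * x'.
-- (The start point (0,0) and the endpoint (n+1,n) satisfy this trivially.)
data SubdiagKimberling (n : ℕ) : ℕ → ℕ → Set where
  done : SubdiagKimberling n (suc n) n
  step : ∀ {x y} (x' y' : ℕ) → x < x' → y ≤ y' → y' * suc n ≤ n * x' →
         SubdiagKimberling n x' y' → SubdiagKimberling n x y

data SchroederPath (n : ℕ) : ℕ → ℕ → Set where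
  done  : SchroederPath n n n
  east  : ∀ {x y} → SchroederPath n (suc x) y → SchroederPath n x y
  north : ∀ {x y} → suc y ≤ x → SchroederPath n x (suc y) → SchroederPath n x y
  diag  : ∀ {x y} → SchroederPath n (suc x) (suc y) → SchroederPath n x y

-- Both families satisfy, up to bijection, the Schröder recurrence
--   S 0 ≅ 1,   S (m + 1) ≅ S m ⊎ Σ_{b ≤ m} S b × S (m ∸ b),
-- and strong induction turns any family satisfying it into finite types, all
-- in bijection with each other.  A Schröder path of size m + 1 either starts
-- with a diagonal step (leaving a path of size m) or with an east step; in the
-- latter case it first returns to the diagonal by a north step onto some
-- (b + 1, b + 1), cutting it into a path of size b and one of size m ∸ b.
-- For 0 < x ≤ n the subdiagonal condition y (n + 1) ≤ n x just says y < x, so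
-- a subdiagonal Kimberling path is a chain of points strictly below y = x with
-- x ≤ n, followed by the forced jump to (n + 1, n).  Such a chain of size
-- m + 1 either avoids the line y = x - 1 (and then, moved one unit left, is a
-- chain of size m) or has a last point (b + 1, b) on it, which cuts it into a
-- chain of size b and one of size m ∸ b.

module Submission where

open import Data.Empty using (⊥-elim)
open import Data.Fin using (Fin)
open import Data.Fin.Properties using (1↔⊤; +↔⊎; *↔×)
open import Data.Nat using (ℕ; zero; suc; _+_; _*_; _∸_; _≤_; _<_; z≤n; s≤s)
open import Data.Nat.Induction using (<-rec)
open import Data.Nat.Properties
  using (≤-refl; ≤-trans; ≤-reflexive; ≤-pred; <⇒≤; <-≤-trans; ≤-<-trans; m≤n⇒m≤1+n; ≤-irrelevant;
         <-irrelevant; n≮n; <⇒≱; ≰⇒>; <-cmp; m≤n⇒m<n∨m≡n; m∸n≤m; m+[n∸m]≡n; m<n+m; +-mono-≤;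
         *-comm; *-suc; *-monoˡ-≤; *-monoʳ-≤; module ≤-Reasoning)
open import Data.Product using (Σ; _×_; _,_; proj₂)
open import Data.Product.Function.Dependent.Propositional using (Σ-↔)
open import Data.Product.Function.NonDependent.Propositional using (_×-↔_)
open import Data.Sum using (_⊎_; inj₁; inj₂)
open import Data.Sum.Function.Propositional using (_⊎-↔_)
open import Data.Unit using (⊤)
open import Function.Base using (_∘_)
open import Function.Bundles using (_↔_; mk↔ₛ′)
open import Function.Properties.Inverse using (↔-refl; ↔-sym; ↔-trans)
open import Relation.Binary.Definitions using (tri<; tri≈; tri>)
open import Relation.Binary.PropositionalEquality
open import Defs

private
  variable
    A B : Set
    P Q : ℕ → Set

Finite : Set → Set
Finite A = Σ ℕ λ k → Fin k ↔ A

finite-resp-↔ : A ↔ B → Finite A → Finite B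
finite-resp-↔ A↔B (k , Fin↔A) = k , ↔-trans Fin↔A A↔B

finite-⊤ : Finite ⊤
finite-⊤ = 1 , 1↔⊤

finite-⊎ : Finite A → Finite B → Finite (A ⊎ B)
finite-⊎ (k , Fin↔A) (l , Fin↔B) = k + l , ↔-trans +↔⊎ (Fin↔A ⊎-↔ Fin↔B)

finite-× : Finite A → Finite B → Finite (A × B)
finite-× (k , Fin↔A) (l , Fin↔B) = k * l , ↔-trans *↔× (Fin↔A ×-↔ Fin↔B)

Σ< : ℕ → (ℕ → Set) → Set
Σ< k P = Σ ℕ λ b → b < k × P b

syntax Σ< k (λ b → B) = Σ[ b < k ] B

Σ<-cong : ∀ {k} → (∀ b → b < k → P b ↔ Q b) → Σ< k P ↔ Σ< k Q
Σ<-cong P↔Q = Σ-↔ ↔-refl λ {b} → Σ-↔ ↔-refl λ {b<k} → P↔Q b b<k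

Σ<-suc↔ : ∀ {k} → Σ< (suc k) P ↔ (P 0 ⊎ Σ< k (P ∘ suc))
Σ<-suc↔ {P} {k} = mk↔ₛ′ to from to∘from from∘to
  where
  to : Σ< (suc k) P → P 0 ⊎ Σ< k (P ∘ suc)
  to (zero  , _       , p) = inj₁ p
  to (suc b , s≤s b<k , p) = inj₂ (b , b<k , p)
  from : P 0 ⊎ Σ< k (P ∘ suc) → Σ< (suc k) P
  from (inj₁ p)             = 0 , s≤s z≤n , p
  from (inj₂ (b , b<k , p)) = suc b , s≤s b<k , p
  to∘from : ∀ z → to (from z) ≡ z
  to∘from (inj₁ p) = refl
  to∘from (inj₂ _) = refl
  from∘to : ∀ z → from (to z) ≡ z
  from∘to (zero  , s≤s z≤n , p) = refl
  from∘to (suc b , s≤s b<k , p) = refl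

finite-Σ< : ∀ k → (∀ b → b < k → Finite (P b)) → Finite (Σ< k P)
finite-Σ< zero    _   = 0 , mk↔ₛ′ (λ ()) (λ { (_ , () , _) }) (λ { (_ , () , _) }) (λ ())
finite-Σ< (suc k) fin = finite-resp-↔ (↔-sym Σ<-suc↔)
  (finite-⊎ (fin 0 (s≤s z≤n)) (finite-Σ< k λ b b<k → fin (suc b) (s≤s b<k)))

Σ-bounded↔Σ< : ∀ {k} → (∀ b → P b → b < k) → Σ ℕ P ↔ Σ< k P
Σ-bounded↔Σ< bound = mk↔ₛ′ (λ (b , p) → b , bound b p , p) (λ (b , _ , p) → b , p)
  (λ (b , b<k , p) → cong (λ b<k′ → b , b<k′ , p) (<-irrelevant _ _)) (λ _ → refl)

Convolution : (ℕ → Set) → ℕ → Set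
Convolution P m = Σ[ b < suc m ] (P b × P (m ∸ b))

record SchröderRecurrence (P : ℕ → Set) : Set₁ where
  field
    zero↔⊤ : P 0 ↔ ⊤
    suc↔   : ∀ m → P (suc m) ↔ (P m ⊎ Convolution P m)

open SchröderRecurrence

finite-recurrent : SchröderRecurrence P → ∀ n → Finite (P n)
finite-recurrent {P} R = <-rec (Finite ∘ P) finite
  where
  finite : ∀ n → (∀ {m} → m < n → Finite (P m)) → Finite (P n)
  finite zero    _   = finite-resp-↔ (↔-sym (zero↔⊤ R)) finite-⊤
  finite (suc m) fin = finite-resp-↔ (↔-sym (suc↔ R m)) (finite-⊎ (fin ≤-refl)
    (finite-Σ< (suc m) λ b b<1+m → finite-× (fin b<1+m) (fin (s≤s (m∸n≤m m b)))))

recurrent-↔ : SchröderRecurrence P → SchröderRecurrence Q → ∀ n → P n ↔ Q n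
recurrent-↔ {P} {Q} R S = <-rec (λ n → P n ↔ Q n) iso
  where
  iso : ∀ n → (∀ {m} → m < n → P m ↔ Q m) → P n ↔ Q n
  iso zero    _  = ↔-trans (zero↔⊤ R) (↔-sym (zero↔⊤ S))
  iso (suc m) ih = ↔-trans (suc↔ R m) (↔-trans
    (ih ≤-refl ⊎-↔ Σ<-cong λ b b<1+m → ih b<1+m ×-↔ ih (s≤s (m∸n≤m m b)))
    (↔-sym (suc↔ S m)))

SchroederPath-bound : ∀ {n x y} → SchroederPath n x y → x ≤ n
SchroederPath-bound done        = ≤-refl
SchroederPath-bound (east p)    = <⇒≤ (SchroederPath-bound p)
SchroederPath-bound (north _ p) = SchroederPath-bound p
SchroederPath-bound (diag p)    = <⇒≤ (SchroederPath-bound p)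

SchroederPath-shift : ∀ {n x y} → SchroederPath n x y ↔ SchroederPath (suc n) (suc x) (suc y)
SchroederPath-shift {n} = mk↔ₛ′ to from to∘from from∘to
  where
  to : ∀ {x y} → SchroederPath n x y → SchroederPath (suc n) (suc x) (suc y)
  to done        = done
  to (east p)    = east (to p)
  to (north h p) = north (s≤s h) (to p)
  to (diag p)    = diag (to p)
  from : ∀ {x y} → SchroederPath (suc n) (suc x) (suc y) → SchroederPath n x y
  from done              = done
  from (east p)          = east (from p)
  from (north (s≤s h) p) = north h (from p)
  from (diag p)          = diag (from p)
  to∘from : ∀ {x y} (p : SchroederPath (suc n) (suc x) (suc y)) → to (from p) ≡ p
  to∘from done              = refl
  to∘from (east p)          = cong east (to∘from p)
  to∘from (north (s≤s h) p) = cong (north (s≤s h)) (to∘from p)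
  to∘from (diag p)          = cong diag (to∘from p)
  from∘to : ∀ {x y} (p : SchroederPath n x y) → from (to p) ≡ p
  from∘to done        = refl
  from∘to (east p)    = cong east (from∘to p)
  from∘to (north h p) = cong (north h) (from∘to p)
  from∘to (diag p)    = cong diag (from∘to p)

SchroederPath-translate : ∀ b {c} → SchroederPath c 0 0 ↔ SchroederPath (b + c) b b
SchroederPath-translate zero    = ↔-refl
SchroederPath-translate (suc b) = ↔-trans (SchroederPath-translate b) SchroederPath-shift

SchroederPath-suffix : ∀ {a m} → a ≤ m → SchroederPath (suc m) (suc a) (suc a) ↔ SchroederPath (m ∸ a) 0 0
SchroederPath-suffix {a} {m} a≤m =
  ↔-sym (subst (λ k → SchroederPath (m ∸ a) 0 0 ↔ SchroederPath k (suc a) (suc a))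
               (cong suc (m+[n∸m]≡n a≤m)) (SchroederPath-translate (suc a)))

SchroederPath-firstStep : ∀ {m} → SchroederPath (suc m) 0 0 ↔ (SchroederPath (suc m) 1 1 ⊎ SchroederPath (suc m) 1 0)
SchroederPath-firstStep {m} = mk↔ₛ′ to from to∘from from∘to
  where
  to : SchroederPath (suc m) 0 0 → SchroederPath (suc m) 1 1 ⊎ SchroederPath (suc m) 1 0
  to (diag p)    = inj₁ p
  to (east p)    = inj₂ p
  to (north () _)
  from : SchroederPath (suc m) 1 1 ⊎ SchroederPath (suc m) 1 0 → SchroederPath (suc m) 0 0
  from (inj₁ p) = diag p
  from (inj₂ p) = east p
  to∘from : ∀ z → to (from z) ≡ z
  to∘from (inj₁ _) = refl
  to∘from (inj₂ _) = refl
  from∘to : ∀ p → from (to p) ≡ p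
  from∘to (diag _)    = refl
  from∘to (east _)    = refl
  from∘to (north () _)

FirstReturn : ℕ → ℕ → ℕ → Set
FirstReturn n x y = Σ ℕ λ a → SchroederPath a x y × SchroederPath n (suc a) (suc a)

SchroederPath-firstReturn : ∀ {n x y} → y ≤ x → SchroederPath n (suc x) y ↔ FirstReturn n x y
SchroederPath-firstReturn {n} y≤x =
  mk↔ₛ′ (to y≤x) from (λ (_ , p , q) → to∘from y≤x p q) (from∘to y≤x)
  where
  prepend : ∀ {x y x′ y′} → (∀ {a} → SchroederPath a x′ y′ → SchroederPath a x y) →
            FirstReturn n x′ y′ → FirstReturn n x y
  prepend f (a , p , q) = a , f p , q
  to : ∀ {x y} → y ≤ x → SchroederPath n (suc x) y → FirstReturn n x y
  to x<x done        = ⊥-elim (n≮n _ x<x)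
  to y≤x (east p)    = prepend east (to (m≤n⇒m≤1+n y≤x) p)
  to y≤x (diag p)    = prepend diag (to (s≤s y≤x) p)
  to y≤x (north _ p) with m≤n⇒m<n∨m≡n y≤x
  ... | inj₁ y<x  = prepend (north y<x) (to y<x p)
  ... | inj₂ refl = _ , done , p
  append : ∀ {a x y} → SchroederPath a x y → SchroederPath n (suc a) (suc a) → SchroederPath n (suc x) y
  append done        q = north ≤-refl q
  append (east p)    q = east (append p q)
  append (north h p) q = north (m≤n⇒m≤1+n h) (append p q)
  append (diag p)    q = diag (append p q)
  from : ∀ {x y} → FirstReturn n x y → SchroederPath n (suc x) y
  from (_ , p , q) = append p q
  to∘from : ∀ {a x y} (y≤x : y ≤ x) p q → to y≤x (append p q) ≡ (a , p , q)
  to∘from y≤x (east p)    q = cong (prepend east) (to∘from _ p q)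
  to∘from y≤x (diag p)    q = cong (prepend diag) (to∘from _ p q)
  to∘from y≤x done        q with m≤n⇒m<n∨m≡n y≤x
  ... | inj₁ x<x  = ⊥-elim (n≮n _ x<x)
  ... | inj₂ refl = refl
  to∘from y≤x (north h p) q with m≤n⇒m<n∨m≡n y≤x
  ... | inj₁ y<x rewrite ≤-irrelevant y<x h = cong (prepend (north h)) (to∘from h p q)
  ... | inj₂ refl = ⊥-elim (n≮n _ h)
  from∘to : ∀ {x y} (y≤x : y ≤ x) p → from (to y≤x p) ≡ p
  from∘to x<x done        = ⊥-elim (n≮n _ x<x)
  from∘to y≤x (east p)    = cong east (from∘to _ p)
  from∘to y≤x (diag p)    = cong diag (from∘to _ p)
  from∘to y≤x (north _ p) with m≤n⇒m<n∨m≡n y≤x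
  ... | inj₁ y<x  = cong₂ north (≤-irrelevant _ _) (from∘to y<x p)
  ... | inj₂ refl = cong₂ north (≤-irrelevant _ _) refl

SchroederPath-recurrence : SchröderRecurrence (λ n → SchroederPath n 0 0)
SchroederPath-recurrence = record { zero↔⊤ = zero↔⊤′ ; suc↔ = suc↔′ }
  where
  zero↔⊤′ : SchroederPath 0 0 0 ↔ ⊤
  zero↔⊤′ = mk↔ₛ′ _ (λ _ → done) (λ _ → refl) λ where
    done         → refl
    (east p)     → ⊥-elim (n≮n 0 (SchroederPath-bound p))
    (diag p)     → ⊥-elim (n≮n 0 (SchroederPath-bound p))
    (north () _)
  suc↔′ : ∀ m → SchroederPath (suc m) 0 0 ↔ (SchroederPath m 0 0 ⊎ Convolution (λ n → SchroederPath n 0 0) m)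
  suc↔′ m = ↔-trans SchroederPath-firstStep (↔-sym SchroederPath-shift ⊎-↔
    ↔-trans (SchroederPath-firstReturn z≤n) (↔-trans
      (Σ-bounded↔Σ< λ _ → SchroederPath-bound ∘ proj₂)
      (Σ<-cong λ _ a<1+m → ↔-refl ×-↔ SchroederPath-suffix (≤-pred a<1+m))))

data Chain (d n : ℕ) : ℕ → ℕ → Set where
  []   : ∀ {x y} → Chain d n x y
  step : ∀ {x y} x′ y′ → x < x′ → x′ ≤ n → y ≤ y′ → d + y′ < x′ → Chain d n x′ y′ → Chain d n x y

step-≡ : ∀ {d n x y x′ y′} {p p′ : x < x′} {q q′ : x′ ≤ n} {u u′ : y ≤ y′} {s s′ : d + y′ < x′}
         {c c′ : Chain d n x′ y′} → c ≡ c′ → step x′ y′ p q u s c ≡ step x′ y′ p′ q′ u′ s′ c′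
step-≡ {p = p} {p′} {q} {q′} {u} {u′} {s} {s′} refl
  rewrite ≤-irrelevant p p′ | ≤-irrelevant q q′ | ≤-irrelevant u u′ | ≤-irrelevant s s′ = refl

Chain-weaken : ∀ {d n x y} → Chain (suc d) n x y → Chain d n x y
Chain-weaken []                     = []
Chain-weaken (step x′ y′ p q u s c) = step x′ y′ p q u (<⇒≤ s) (Chain-weaken c)

Chain-shift : ∀ {n x y} → Chain 0 n x y ↔ Chain 0 (suc n) (suc x) (suc y)
Chain-shift {n} = mk↔ₛ′ to from to∘from from∘to
  where
  to : ∀ {x y} → Chain 0 n x y → Chain 0 (suc n) (suc x) (suc y)
  to []                     = []
  to (step x′ y′ p q u s c) = step (suc x′) (suc y′) (s≤s p) (s≤s q) (s≤s u) (s≤s s) (to c)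
  from : ∀ {x y} → Chain 0 (suc n) (suc x) (suc y) → Chain 0 n x y
  from []                                                       = []
  from (step (suc x′) (suc y′) (s≤s p) (s≤s q) (s≤s u) (s≤s s) c) = step x′ y′ p q u s (from c)
  to∘from : ∀ {x y} (c : Chain 0 (suc n) (suc x) (suc y)) → to (from c) ≡ c
  to∘from []                                                       = refl
  to∘from (step (suc _) (suc _) (s≤s _) (s≤s _) (s≤s _) (s≤s _) c) = step-≡ (to∘from c)
  from∘to : ∀ {x y} (c : Chain 0 n x y) → from (to c) ≡ c
  from∘to []                   = refl
  from∘to (step _ _ _ _ _ _ c) = step-≡ (from∘to c)

Chain-translate : ∀ b {c} → Chain 0 c 0 0 ↔ Chain 0 (b + c) b b
Chain-translate zero    = ↔-refl
Chain-translate (suc b) = ↔-trans (Chain-translate b) Chain-shift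

Chain-shiftˣ : ∀ {d m x y} → Chain d m x y ↔ Chain (suc d) (suc m) (suc x) y
Chain-shiftˣ {d} {m} = mk↔ₛ′ to from to∘from from∘to
  where
  to : ∀ {x y} → Chain d m x y → Chain (suc d) (suc m) (suc x) y
  to []                     = []
  to (step x′ y′ p q u s c) = step (suc x′) y′ (s≤s p) (s≤s q) u (s≤s s) (to c)
  from : ∀ {x y} → Chain (suc d) (suc m) (suc x) y → Chain d m x y
  from []                                             = []
  from (step (suc x′) y′ (s≤s p) (s≤s q) u (s≤s s) c) = step x′ y′ p q u s (from c)
  to∘from : ∀ {x y} (c : Chain (suc d) (suc m) (suc x) y) → to (from c) ≡ c
  to∘from []                                           = refl
  to∘from (step (suc _) _ (s≤s _) (s≤s _) _ (s≤s _) c) = step-≡ (to∘from c)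
  from∘to : ∀ {x y} (c : Chain d m x y) → from (to c) ≡ c
  from∘to []                   = refl
  from∘to (step _ _ _ _ _ _ c) = step-≡ (from∘to c)

Chain-start-0↔1 : ∀ {d m y} → Chain (suc d) m 0 y ↔ Chain (suc d) m 1 y
Chain-start-0↔1 = mk↔ₛ′ to from to∘from from∘to
  where
  to : ∀ {d m y} → Chain (suc d) m 0 y → Chain (suc d) m 1 y
  to []                     = []
  to (step x′ y′ _ q u s c) = step x′ y′ (≤-trans (s≤s (s≤s z≤n)) s) q u s c
  from : ∀ {d m y} → Chain (suc d) m 1 y → Chain (suc d) m 0 y
  from []                     = []
  from (step x′ y′ p q u s c) = step x′ y′ (<⇒≤ p) q u s c
  to∘from : ∀ {d m y} (c : Chain (suc d) m 1 y) → to (from c) ≡ c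
  to∘from []                   = refl
  to∘from (step _ _ _ _ _ _ _) = step-≡ refl
  from∘to : ∀ {d m y} (c : Chain (suc d) m 0 y) → from (to c) ≡ c
  from∘to []                   = refl
  from∘to (step _ _ _ _ _ _ _) = step-≡ refl

LastOnLine : ℕ → ℕ → ℕ → Set
LastOnLine n x y = Σ[ b < n ] ((x ≤ b × y ≤ b) × Chain 0 b x y × Chain 1 n (suc b) b)

Chain-lastOnLine : ∀ {n x y} → Chain 0 n x y ↔ (Chain 1 n x y ⊎ LastOnLine n x y)
Chain-lastOnLine {n} = mk↔ₛ′ to from to∘from from∘to
  where
  to : ∀ {x y} → Chain 0 n x y → Chain 1 n x y ⊎ LastOnLine n x y
  to []                     = inj₁ []
  to (step x′ y′ p q u s c) with to c
  ... | inj₂ (b , b<n , (x′≤b , y′≤b) , before , after) =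
    inj₂ (b , b<n , (<⇒≤ (<-≤-trans p x′≤b) , ≤-trans u y′≤b) , step x′ y′ p x′≤b u s before , after)
  ... | inj₁ c₁ with m≤n⇒m<n∨m≡n s
  ...   | inj₁ 1+y′<x′ = inj₁ (step x′ y′ p q u 1+y′<x′ c₁)
  ...   | inj₂ refl    = inj₂ (y′ , q , (≤-pred p , u) , [] , c₁)
  append : ∀ {b x y} → Chain 0 b x y → x ≤ b × y ≤ b → b < n → Chain 1 n (suc b) b → Chain 0 n x y
  append [] (x≤b , y≤b) b<n after = step _ _ (s≤s x≤b) b<n y≤b ≤-refl (Chain-weaken after)
  append (step x′ y′ p q u s c) _ b<n after =
    step x′ y′ p (≤-trans q (<⇒≤ b<n)) u s (append c (q , <⇒≤ (<-≤-trans s q)) b<n after)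
  from : ∀ {x y} → Chain 1 n x y ⊎ LastOnLine n x y → Chain 0 n x y
  from (inj₁ c)                                 = Chain-weaken c
  from (inj₂ (_ , b<n , xy≤b , before , after)) = append before xy≤b b<n after
  to∘weaken : ∀ {x y} (c : Chain 1 n x y) → to (Chain-weaken c) ≡ inj₁ c
  to∘weaken [] = refl
  to∘weaken (step _ _ _ _ _ s c) rewrite to∘weaken c with m≤n⇒m<n∨m≡n (<⇒≤ s)
  ... | inj₁ _    = cong inj₁ (step-≡ refl)
  ... | inj₂ refl = ⊥-elim (n≮n _ s)
  to∘append : ∀ {b x y} (before : Chain 0 b x y) xy≤b b<n after →
              to (append before xy≤b b<n after) ≡ inj₂ (b , b<n , xy≤b , before , after)
  -- `rewrite to∘weaken after` would normalise away the pending test on ≤-refl,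
  -- which `with` could then no longer abstract.
  to∘append {b} [] _ _ after with to (Chain-weaken after) | to∘weaken after
  ... | _ | refl with m≤n⇒m<n∨m≡n (≤-refl {suc b})
  ...   | inj₁ b<b  = ⊥-elim (n≮n _ b<b)
  ...   | inj₂ refl = refl
  to∘append (step _ _ _ q _ s c) _ b<n after rewrite to∘append c (q , <⇒≤ (<-≤-trans s q)) b<n after =
    cong (λ xy≤b → inj₂ (_ , b<n , xy≤b , _ , after)) (cong₂ _,_ (≤-irrelevant _ _) (≤-irrelevant _ _))
  to∘from : ∀ {x y} (z : Chain 1 n x y ⊎ LastOnLine n x y) → to (from z) ≡ z
  to∘from (inj₁ c)                                 = to∘weaken c
  to∘from (inj₂ (_ , b<n , xy≤b , before , after)) = to∘append before xy≤b b<n after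
  from∘to : ∀ {x y} (c : Chain 0 n x y) → from (to c) ≡ c
  from∘to [] = refl
  from∘to (step x′ y′ p q u s c) with to c | from∘to c
  ... | inj₂ (b , b<n , (x′≤b , _) , before , after) | before++after≡c =
    step-≡ (trans (cong (λ y′≤b → append before (x′≤b , y′≤b) b<n after) (≤-irrelevant _ _)) before++after≡c)
  ... | inj₁ c₁ | weaken≡c with m≤n⇒m<n∨m≡n s
  ...   | inj₁ _    = step-≡ weaken≡c
  ...   | inj₂ refl = step-≡ weaken≡c

Chain-suffix : ∀ {b m} → b ≤ m → Chain 1 (suc m) (suc b) b ↔ Chain 0 (m ∸ b) 0 0
Chain-suffix {b} {m} b≤m = ↔-trans (↔-sym Chain-shiftˣ)
  (↔-sym (subst (λ k → Chain 0 (m ∸ b) 0 0 ↔ Chain 0 k b b) (m+[n∸m]≡n b≤m) (Chain-translate b)))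

Chain-recurrence : SchröderRecurrence (λ n → Chain 0 n 0 0)
Chain-recurrence = record { zero↔⊤ = zero↔⊤′ ; suc↔ = suc↔′ }
  where
  zero↔⊤′ : Chain 0 0 0 0 ↔ ⊤
  zero↔⊤′ = mk↔ₛ′ _ (λ _ → []) (λ _ → refl) λ where
    []                   → refl
    (step _ _ p q _ _ _) → ⊥-elim (n≮n 0 (≤-trans p q))
  drop-origin : ∀ {b} → ((0 ≤ b × 0 ≤ b) × A) ↔ A
  drop-origin = mk↔ₛ′ proj₂ ((z≤n , z≤n) ,_) (λ _ → refl) λ where ((z≤n , z≤n) , _) → refl
  suc↔′ : ∀ m → Chain 0 (suc m) 0 0 ↔ (Chain 0 m 0 0 ⊎ Convolution (λ n → Chain 0 n 0 0) m)
  suc↔′ m = ↔-trans Chain-lastOnLine (↔-trans Chain-start-0↔1 (↔-sym Chain-shiftˣ) ⊎-↔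
    Σ<-cong λ _ b<1+m → ↔-trans drop-origin (↔-refl ×-↔ Chain-suffix (≤-pred b<1+m)))

below⇒subdiagonal : ∀ {n x y} → y < x → x ≤ n → y * suc n ≤ n * x
below⇒subdiagonal {n} {suc x} {y} (s≤s y≤x) x<n = begin
  y * suc n ≤⟨ *-monoˡ-≤ (suc n) y≤x ⟩
  x * suc n ≡⟨ *-suc x n ⟩
  x + x * n ≤⟨ +-mono-≤ (<⇒≤ x<n) (≤-reflexive (*-comm x n)) ⟩
  n + n * x ≡⟨ *-suc n x ⟨
  n * suc x ∎
  where open ≤-Reasoning

subdiagonal⇒below : ∀ {n x y} → 0 < x → y * suc n ≤ n * x → y < x
subdiagonal⇒below {n} {x} {y} 0<x subdiagonal = ≰⇒> λ x≤y → <⇒≱ (begin-strict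
  n * x     <⟨ m<n+m (n * x) 0<x ⟩
  x + n * x ≤⟨ +-mono-≤ x≤y (*-monoʳ-≤ n x≤y) ⟩
  y + n * y ≡⟨ cong (y +_) (*-comm n y) ⟩
  y + y * n ≡⟨ *-suc y n ⟨
  y * suc n ∎) subdiagonal
  where open ≤-Reasoning

Kimberling-bound : ∀ {n x y} → SubdiagKimberling n x y → x ≤ suc n
Kimberling-bound done              = ≤-refl
Kimberling-bound (step _ _ p _ _ k) = <⇒≤ (<-≤-trans p (Kimberling-bound k))

Kimberling-step-≡ : ∀ {n x y x′ y′} {p p′ : x < x′} {u u′ : y ≤ y′} {h h′ : y′ * suc n ≤ n * x′}
                    {k k′ : SubdiagKimberling n x′ y′} → k ≡ k′ → step x′ y′ p u h k ≡ step x′ y′ p′ u′ h′ k′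
Kimberling-step-≡ {p = p} {p′} {u} {u′} {h} {h′} refl
  rewrite ≤-irrelevant p p′ | ≤-irrelevant u u′ | ≤-irrelevant h h′ = refl

Kimberling↔Chain : ∀ {n} → SubdiagKimberling n 0 0 ↔ Chain 0 n 0 0
Kimberling↔Chain {n} = mk↔ₛ′ (to z≤n) (from z≤n z≤n) (to∘from z≤n z≤n) (from∘to z≤n z≤n)
  where
  to : ∀ {x y} → x ≤ n → SubdiagKimberling n x y → Chain 0 n x y
  to 1+n≤n done = ⊥-elim (n≮n _ 1+n≤n)
  to _ (step x′ y′ p u h k) with <-cmp x′ (suc n)
  ... | tri< x′<1+n _ _ =
    step x′ y′ p (≤-pred x′<1+n) u (subdiagonal⇒below (≤-<-trans z≤n p) h) (to (≤-pred x′<1+n) k)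
  ... | tri≈ _ refl _   = []
  ... | tri> _ _ 1+n<x′ = ⊥-elim (<⇒≱ 1+n<x′ (Kimberling-bound k))
  from : ∀ {x y} → x ≤ n → y ≤ n → Chain 0 n x y → SubdiagKimberling n x y
  from x≤n y≤n []                     = step (suc n) n (s≤s x≤n) y≤n ≤-refl done
  from _   _   (step x′ y′ p q u s c) = step x′ y′ p u (below⇒subdiagonal s q) (from q (<⇒≤ (<-≤-trans s q)) c)
  to∘from : ∀ {x y} (x≤n : x ≤ n) (y≤n : y ≤ n) (c : Chain 0 n x y) → to x≤n (from x≤n y≤n c) ≡ c
  to∘from _ _ [] with <-cmp (suc n) (suc n)
  ... | tri< 1+n<1+n _ _ = ⊥-elim (n≮n _ 1+n<1+n)
  ... | tri≈ _ refl _    = refl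
  ... | tri> _ _ 1+n<1+n = ⊥-elim (n≮n _ 1+n<1+n)
  to∘from _ _ (step x′ y′ p q u s c) with <-cmp x′ (suc n)
  ... | tri< _ _ _ =
    step-≡ (trans (cong (λ x′≤n → to x′≤n (from q y′≤n c)) (≤-irrelevant _ q)) (to∘from q y′≤n c))
    where y′≤n = <⇒≤ (<-≤-trans s q)
  ... | tri≈ _ refl _   = ⊥-elim (n≮n _ q)
  ... | tri> _ _ 1+n<x′ = ⊥-elim (<⇒≱ 1+n<x′ (m≤n⇒m≤1+n q))
  from∘to : ∀ {x y} (x≤n : x ≤ n) (y≤n : y ≤ n) (k : SubdiagKimberling n x y) → from x≤n y≤n (to x≤n k) ≡ k
  from∘to 1+n≤n _ done = ⊥-elim (n≮n _ 1+n≤n)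
  from∘to _ _ (step x′ y′ p u h k) with <-cmp x′ (suc n)
  ... | tri< _ _ _     = Kimberling-step-≡ (from∘to _ _ k)
  ... | tri> _ _ 1+n<x′ = ⊥-elim (<⇒≱ 1+n<x′ (Kimberling-bound k))
  ... | tri≈ _ refl _ with k
  ...   | done               = Kimberling-step-≡ refl
  ...   | step _ _ p′ _ _ k′ = ⊥-elim (<⇒≱ p′ (Kimberling-bound k′))

mainTheorem3 : (n : ℕ) → Σ ℕ (λ k → (Fin k ↔ SubdiagKimberling n zero zero) × (Fin k ↔ SchroederPath n zero zero))
mainTheorem3 n with finite-recurrent SchroederPath-recurrence n
... | k , Fin↔Schroeder = k ,
  ↔-trans Fin↔Schroeder (↔-trans (recurrent-↔ SchroederPath-recurrence Chain-recurrence n) (↔-sym Kimberling↔Chain)) ,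
  Fin↔Schroeder
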